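{- Let $G$ be a finite undirected simple graph. Then the number of subsets $V_1\subseteq V(G)$ such that both $G[V_1]$ and $G[V(G)\setminus V_1]$ are even induced subgraphs equals the number of odd-parity covers of the odd-extension $\overline{G}$ of $G$.
   Context: An induced subgraph is even if every vertex has even degree in it. The odd-extension $\overline{G}$ of $G$ is the graph obtained from $G$ by attaching, to every vertex $v\in V(G)$ of even degree in $G$, a new vertex $v'$ adjacent only to $v$. For a graph $\Gamma$ and $v\in V(\Gamma)$, $N_\Gamma[v]$ denotes the closed neighbourhood $\{w: w\sim v\}\cup\{v\}$. A set $Q\subseteq V(\Gamma)$ is an odd-parity cover of $\Gamma$ if $|N_\Gamma[v]\cap Q|$ is odd for every $v\in V(\Gamma)$. -}

module Defs where

open import Data.Bool using (Bool; true; false; _∧_; if_then_else_)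
open import Data.Nat using (ℕ; zero; suc; _+_; _%_)
open import Data.Fin using (Fin; splitAt)
import Data.Fin.Properties as Fin
open import Data.Fin.Properties using (all?)
import Data.Nat as ℕ
import Data.Bool as Bool
import Data.List as List
open import Data.Product using (_×_)
open import Relation.Unary using (Decidable)
open import Relation.Nullary using (Dec)
open import Relation.Nullary.Decidable using (_→-dec_; _×-dec_)
open import Data.Sum using (_⊎_; inj₁; inj₂)
open import Data.Vec using (Vec; []; _∷_; lookup; allFin; countᵇ)
open import Data.List using (List; []; _∷_; _++_; map; length; filter)
open import Data.Fin.Subset using (Subset; ∁)
open import Relation.Binary.PropositionalEquality using (_≡_; refl)
open import Relation.Nullary using (does)

record Graph (n : ℕ) : Set where
  field
    adj   : Fin n → Fin n → Bool
    sym   : ∀ i j → adj i j ≡ adj j i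
    irrfl : ∀ i → adj i i ≡ false
open Graph public

_∈ᵇ_ : ∀ {n} → Fin n → Subset n → Bool
i ∈ᵇ S = lookup S i

isEven : ℕ → Set
isEven k = k % 2 ≡ 0

isOdd : ℕ → Set
isOdd k = k % 2 ≡ 1

deg : ∀ {n} → Graph n → Fin n → ℕ
deg G v = countᵇ (λ j → adj G v j) (allFin _)

degIn : ∀ {n} → Graph n → Subset n → Fin n → ℕ
degIn G S v = countᵇ (λ j → adj G v j ∧ (j ∈ᵇ S)) (allFin _)

EvenInduced : ∀ {n} → Graph n → Subset n → Set
EvenInduced G S = ∀ v → v ∈ᵇ S ≡ true → isEven (degIn G S v)

closedNbhdMeet : ∀ {n} → Graph n → Subset n → Fin n → ℕ
closedNbhdMeet G Q v = (if v ∈ᵇ Q then 1 else 0) + degIn G Q v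

OddParityCover : ∀ {n} → Graph n → Subset n → Set
OddParityCover G Q = ∀ v → isOdd (closedNbhdMeet G Q v)

allSubsets : ∀ n → List (Subset n)
allSubsets zero    = [] ∷ []
allSubsets (suc n) = map (true ∷_) (allSubsets n) ++ map (false ∷_) (allSubsets n)

countSubsets : ∀ n {P : Subset n → Set} → Decidable P → ℕ
countSubsets n P? = length (filter P? (allSubsets n))

isEven? : ∀ k → Dec (isEven k)
isEven? k = k % 2 ℕ.≟ 0

isOdd? : ∀ k → Dec (isOdd k)
isOdd? k = k % 2 ℕ.≟ 1

EvenInduced? : ∀ {n} (G : Graph n) → Decidable (EvenInduced G)
EvenInduced? G S = all? (λ v → (v ∈ᵇ S Bool.≟ true) →-dec isEven? (degIn G S v))

OddParityCover? : ∀ {n} (G : Graph n) → Decidable (OddParityCover G)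
OddParityCover? G Q = all? (λ v → isOdd? (closedNbhdMeet G Q v))

EvenSplit : ∀ {n} → Graph n → Subset n → Set
EvenSplit G S = EvenInduced G S × EvenInduced G (∁ S)

EvenSplit? : ∀ {n} (G : Graph n) → Decidable (EvenSplit G)
EvenSplit? G S = EvenInduced? G S ×-dec EvenInduced? G (∁ S)

-- The even-degree vertices of G, listed in increasing order,
-- are evenVerts G; the new pendant vertex attached to the k-th even vertex
-- is the vertex n ↑ʳ k of Fin (n + m), m = number of even-degree vertices.
evenVerts : ∀ {n} → Graph n → List (Fin n)
evenVerts G = filter (λ v → isEven? (deg G v)) (List.allFin _)

numEven : ∀ {n} → Graph n → ℕ
numEven G = length (evenVerts G)

owner : ∀ {n} (G : Graph n) → Fin (numEven G) → Fin n
owner G k = List.lookup (evenVerts G) k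

extAdj : ∀ {n} (G : Graph n) → Fin (n + numEven G) → Fin (n + numEven G) → Bool
extAdj {n} G x y with splitAt n x | splitAt n y
... | inj₁ i | inj₁ j = adj G i j
... | inj₁ i | inj₂ k = does (owner G k Fin.≟ i)
... | inj₂ k | inj₁ i = does (owner G k Fin.≟ i)
... | inj₂ k | inj₂ l = false

extSym : ∀ {n} (G : Graph n) → ∀ x y → extAdj G x y ≡ extAdj G y x
extSym {n} G x y with splitAt n x | splitAt n y
... | inj₁ i | inj₁ j = sym G i j
... | inj₁ i | inj₂ k = refl
... | inj₂ k | inj₁ i = refl
... | inj₂ k | inj₂ l = refl

extIrr : ∀ {n} (G : Graph n) → ∀ x → extAdj G x x ≡ false
extIrr {n} G x with splitAt n x
... | inj₁ i = irrfl G i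
... | inj₂ k = refl

oddExtension : ∀ {n} (G : Graph n) → Graph (n + numEven G)
oddExtension G = record { adj = extAdj G ; sym = extSym G ; irrfl = extIrr G }

{-# OPTIONS --safe #-}

-- Split a subset of V(Ḡ) as S ++ T, with S ⊆ V(G) and T a set of pendant vertices.
-- The closed neighbourhood of the pendant attached to v is {pendant, v}, so in an
-- odd-parity cover the pendant lies in T exactly when v ∉ S: T is determined by S.
-- For that T, a vertex v ∈ S meets the cover in 1 + deg_S v vertices, which is odd
-- iff deg_S v is even; a vertex v ∉ S meets it in deg_S v + [deg v even] vertices,
-- and since deg v = deg_S v + deg_{V∖S} v this is odd iff deg_{V∖S} v is even.
-- So S ↦ S ++ T is a bijection from even splits of G onto odd-parity covers of Ḡ.

module Submission where

open import Defs
open import Data.Nat using (ℕ; _+_)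
open import Relation.Binary.PropositionalEquality using (_≡_)

open import Data.Bool using (Bool; true; false; not; _∧_; if_then_else_)
open import Data.Bool.Properties using (∧-identityʳ; ∧-zeroʳ; not-injective)
open import Data.Fin using (Fin; zero; suc; _↑ˡ_; _↑ʳ_; punchIn)
open import Data.Fin.Properties using (_≟_; punchInᵢ≢i; splitAt-↑ˡ; splitAt-↑ʳ)
open import Data.Fin.Subset using (Subset; ∁)
open import Data.List using (List; []; _∷_; filter; length)
import Data.List as List
open import Data.List.Properties using (filter-++; length-++; filter-none)
import Data.List.Relation.Unary.All as All
open import Data.Nat using (suc; parity)
open import Data.Nat.ListAction using () renaming (sum to sumᴸ)
open import Data.Nat.Properties using (+-0-commutativeMonoid; +-identityʳ; +-assoc; +-suc)
open import Data.Parity using (1ℙ)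
import Data.Parity as ℙ
open import Data.Parity.Properties using (+-homo-+; p+p≡0ℙ) renaming (+-assoc to ℙ-+-assoc)
open import Data.Vec using ([]; _∷_; _++_; lookup; tabulate; countᵇ)
open import Data.Vec.Properties
  using (∷-injectiveʳ; lookup-++ˡ; lookup-++ʳ; lookup-map; lookup∘tabulate; tabulate∘lookup; tabulate-cong)
open import Data.Product using (_,_)
open import Function using (id; _∘_; case_of_; _⇔_; mk⇔; Equivalence)
open import Function.Construct.Composition using (_⇔-∘_)
import Relation.Binary.PropositionalEquality as ≡
open ≡ using (_≢_; refl; trans; cong; cong₂; subst; module ≡-Reasoning)
open import Relation.Nullary using (¬_; does; yes; no)
open import Relation.Nullary.Decidable using (does-⇔; dec-true; dec-false)
open import Relation.Unary using (Decidable)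

open import Algebra.Properties.CommutativeMonoid.Sum +-0-commutativeMonoid
  using (sum-syntax; sum-cong-≗; sum-replicate-zero; sum-remove; ∑-distrib-+)
open Equivalence using (to; from)
open ≡-Reasoning

⟦_⟧ : Bool → ℕ
⟦ b ⟧ = if b then 1 else 0

⟦⟧-split : ∀ a s → ⟦ a ⟧ ≡ ⟦ a ∧ s ⟧ + ⟦ a ∧ not s ⟧
⟦⟧-split true  true  = refl
⟦⟧-split true  false = refl
⟦⟧-split false _     = refl

-- The recursive clauses below typecheck because (2 + k) % 2 computes to k % 2.
isOdd⇔parity≡1ℙ : ∀ k → isOdd k ⇔ parity k ≡ 1ℙ
isOdd⇔parity≡1ℙ 0             = mk⇔ (λ ()) (λ ())
isOdd⇔parity≡1ℙ 1             = mk⇔ (λ _ → refl) (λ _ → refl)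
isOdd⇔parity≡1ℙ (suc (suc k)) = isOdd⇔parity≡1ℙ k

isOdd-suc⇔isEven : ∀ k → isOdd (suc k) ⇔ isEven k
isOdd-suc⇔isEven 0             = mk⇔ (λ _ → refl) (λ _ → refl)
isOdd-suc⇔isEven 1             = mk⇔ (λ ()) (λ ())
isOdd-suc⇔isEven (suc (suc k)) = isOdd-suc⇔isEven k

isOdd-cong-parity : ∀ {a b} → parity a ≡ parity b → isOdd a ⇔ isOdd b
isOdd-cong-parity {a} {b} eq = mk⇔
  (λ odd-a → from (isOdd⇔parity≡1ℙ b) (trans (≡.sym eq) (to (isOdd⇔parity≡1ℙ a) odd-a)))
  (λ odd-b → from (isOdd⇔parity≡1ℙ a) (trans eq (to (isOdd⇔parity≡1ℙ b) odd-b)))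

parity-⟦isEven?⟧ : ∀ k → parity ⟦ does (isEven? k) ⟧ ≡ parity (suc k)
parity-⟦isEven?⟧ 0             = refl
parity-⟦isEven?⟧ 1             = refl
parity-⟦isEven?⟧ (suc (suc k)) = parity-⟦isEven?⟧ k

parity-+-⟦isEven?⟧ : ∀ a c → parity (a + ⟦ does (isEven? (a + c)) ⟧) ≡ parity (suc c)
parity-+-⟦isEven?⟧ a c = begin
  parity (a + ⟦ does (isEven? (a + c)) ⟧)        ≡⟨ +-homo-+ a _ ⟩
  parity a ℙ.+ parity ⟦ does (isEven? (a + c)) ⟧ ≡⟨ cong (parity a ℙ.+_) (parity-⟦isEven?⟧ (a + c)) ⟩
  parity a ℙ.+ parity (suc (a + c))              ≡⟨ cong (λ x → parity a ℙ.+ parity x) (+-suc a c) ⟨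
  parity a ℙ.+ parity (a + suc c)                ≡⟨ cong (parity a ℙ.+_) (+-homo-+ a (suc c)) ⟩
  parity a ℙ.+ (parity a ℙ.+ parity (suc c))     ≡⟨ ℙ-+-assoc (parity a) _ _ ⟨
  (parity a ℙ.+ parity a) ℙ.+ parity (suc c)     ≡⟨ cong (ℙ._+ parity (suc c)) (p+p≡0ℙ (parity a)) ⟩
  parity (suc c)                                 ∎

isOdd-+-⟦isEven?⟧ : ∀ a c → isOdd (a + ⟦ does (isEven? (a + c)) ⟧) ⇔ isEven c
isOdd-+-⟦isEven?⟧ a c = isOdd-suc⇔isEven c ⇔-∘ isOdd-cong-parity {a + _} {suc c} (parity-+-⟦isEven?⟧ a c)

isOdd-⟦⟧+⟦⟧ : ∀ a b → isOdd (⟦ a ⟧ + ⟦ b ⟧) ⇔ (a ≡ not b)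
isOdd-⟦⟧+⟦⟧ true  true  = mk⇔ (λ ()) (λ ())
isOdd-⟦⟧+⟦⟧ true  false = mk⇔ (λ _ → refl) (λ _ → refl)
isOdd-⟦⟧+⟦⟧ false true  = mk⇔ (λ _ → refl) (λ _ → refl)
isOdd-⟦⟧+⟦⟧ false false = mk⇔ (λ ()) (λ ())

countᵇ-tabulate : ∀ {n} {A : Set} (p : A → Bool) (f : Fin n → A) →
                  countᵇ p (tabulate f) ≡ ∑[ i < n ] ⟦ p (f i) ⟧
countᵇ-tabulate {0}     p f = refl
countᵇ-tabulate {suc n} p f with p (f zero)
... | true  = cong suc (countᵇ-tabulate p (f ∘ suc))
... | false = countᵇ-tabulate p (f ∘ suc)

∑-↑ : ∀ n {m} (f : Fin (n + m) → ℕ) →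
      ∑[ x < n + m ] f x ≡ ∑[ i < n ] f (i ↑ˡ m) + ∑[ k < m ] f (n ↑ʳ k)
∑-↑ 0       f = refl
∑-↑ (suc n) f = trans (cong (f zero +_) (∑-↑ n (f ∘ suc))) (≡.sym (+-assoc (f zero) _ _))

∑-zero : ∀ {n} (f : Fin n → ℕ) → (∀ i → f i ≡ 0) → ∑[ i < n ] f i ≡ 0
∑-zero {n} f vanish = trans (sum-cong-≗ vanish) (sum-replicate-zero n)

∑-single : ∀ {n} (f : Fin n → ℕ) (i : Fin n) → (∀ j → j ≢ i → f j ≡ 0) → ∑[ j < n ] f j ≡ f i
∑-single {suc n} f i vanish = begin
  ∑[ j < suc n ] f j                      ≡⟨ sum-remove f ⟩
  f i + ∑[ j < n ] f (punchIn i j)        ≡⟨ cong (f i +_) (∑-zero _ λ j → vanish (punchIn i j) (punchInᵢ≢i i j)) ⟩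
  f i + 0                                 ≡⟨ +-identityʳ (f i) ⟩
  f i                                     ∎

↑-elim : ∀ n {m} {P : Fin (n + m) → Set} → (∀ i → P (i ↑ˡ m)) → (∀ k → P (n ↑ʳ k)) → ∀ x → P x
↑-elim 0       left right x       = right x
↑-elim (suc n) left right zero    = left zero
↑-elim (suc n) left right (suc x) = ↑-elim n (left ∘ suc) right x

∑-lookup : ∀ {A : Set} (xs : List A) (f : A → ℕ) →
           ∑[ k < length xs ] f (List.lookup xs k) ≡ sumᴸ (List.map f xs)
∑-lookup []       f = refl
∑-lookup (x ∷ xs) f = cong (f x +_) (∑-lookup xs f)

sum-map-filter : ∀ {A : Set} {P : A → Set} (P? : Decidable P) (f : A → ℕ) (xs : List A) →
                 sumᴸ (List.map f (filter P? xs)) ≡ sumᴸ (List.map (λ x → if does (P? x) then f x else 0) xs)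
sum-map-filter P? f []       = refl
sum-map-filter P? f (x ∷ xs) with does (P? x)
... | true  = cong (f x +_) (sum-map-filter P? f xs)
... | false = sum-map-filter P? f xs

sum-map-tabulate : ∀ {n} {A : Set} (f : A → ℕ) (g : Fin n → A) →
                   sumᴸ (List.map f (List.tabulate g)) ≡ ∑[ i < n ] f (g i)
sum-map-tabulate {0}     f g = refl
sum-map-tabulate {suc n} f g = cong (f (g zero) +_) (sum-map-tabulate f (g ∘ suc))

occurrences-filter-allFin : ∀ {n} {P : Fin n → Set} (P? : Decidable P) (i : Fin n) →
  ∑[ k < length (filter P? (List.allFin n)) ] ⟦ does (List.lookup (filter P? (List.allFin n)) k ≟ i) ⟧
  ≡ ⟦ does (P? i) ⟧
occurrences-filter-allFin {n} P? i = begin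
  _                                             ≡⟨ ∑-lookup (filter P? (List.allFin n)) δ ⟩
  sumᴸ (List.map δ (filter P? (List.allFin n))) ≡⟨ sum-map-filter P? δ (List.allFin n) ⟩
  sumᴸ (List.map δ∧P (List.allFin n))           ≡⟨ sum-map-tabulate δ∧P id ⟩
  ∑[ j < n ] δ∧P j                              ≡⟨ ∑-single δ∧P i off-diagonal ⟩
  δ∧P i                                         ≡⟨ diagonal ⟩
  ⟦ does (P? i) ⟧                               ∎
  where
  δ : Fin n → ℕ
  δ j = ⟦ does (j ≟ i) ⟧
  δ∧P : Fin n → ℕ
  δ∧P j = if does (P? j) then δ j else 0
  off-diagonal : ∀ j → j ≢ i → δ∧P j ≡ 0
  off-diagonal j j≢i rewrite dec-false (j ≟ i) j≢i with does (P? j)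
  ... | true  = refl
  ... | false = refl
  diagonal : δ∧P i ≡ ⟦ does (P? i) ⟧
  diagonal rewrite dec-true (i ≟ i) refl with does (P? i)
  ... | true  = refl
  ... | false = refl

length-filter-∷ : ∀ {A : Set} {P : A → Set} (P? : Decidable P) x (xs : List A) →
                  length (filter P? (x ∷ xs)) ≡ ⟦ does (P? x) ⟧ + length (filter P? xs)
length-filter-∷ P? x xs with does (P? x)
... | true  = refl
... | false = refl

length-filter-map : ∀ {A B : Set} {P : B → Set} (P? : Decidable P) (f : A → B) (xs : List A) →
                    length (filter P? (List.map f xs)) ≡ length (filter (P? ∘ f) xs)
length-filter-map P? f []       = refl
length-filter-map P? f (x ∷ xs) with does (P? (f x))
... | true  = cong suc (length-filter-map P? f xs)
... | false = length-filter-map P? f xs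

countSubsets-zero : ∀ {P : Subset 0 → Set} (P? : Decidable P) → countSubsets 0 P? ≡ ⟦ does (P? []) ⟧
countSubsets-zero P? = trans (length-filter-∷ P? [] []) (+-identityʳ _)

countSubsets-suc : ∀ n {P : Subset (suc n) → Set} (P? : Decidable P) →
  countSubsets (suc n) P? ≡ countSubsets n (P? ∘ (true ∷_)) + countSubsets n (P? ∘ (false ∷_))
countSubsets-suc n P? = begin
  length (filter P? (half true List.++ half false))
    ≡⟨ cong length (filter-++ P? (half true) _) ⟩
  length (filter P? (half true) List.++ filter P? (half false))
    ≡⟨ length-++ (filter P? (half true)) ⟩
  length (filter P? (half true)) + length (filter P? (half false))
    ≡⟨ cong₂ _+_ (count-half true) (count-half false) ⟩
  countSubsets n (P? ∘ (true ∷_)) + countSubsets n (P? ∘ (false ∷_))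
    ∎
  where
  half : Bool → List (Subset (suc n))
  half b = List.map (b ∷_) (allSubsets n)
  count-half : ∀ b → length (filter P? (half b)) ≡ countSubsets n (P? ∘ (b ∷_))
  count-half b = length-filter-map P? (b ∷_) (allSubsets n)

countSubsets-none : ∀ n {P : Subset n → Set} (P? : Decidable P) → (∀ S → ¬ P S) → countSubsets n P? ≡ 0
countSubsets-none n P? none = cong length (filter-none P? (All.universal none (allSubsets n)))

countSubsets-unique : ∀ n {P : Subset n → Set} (P? : Decidable P) (t : Subset n) →
                      (∀ S → P S → S ≡ t) → countSubsets n P? ≡ ⟦ does (P? t) ⟧
countSubsets-unique 0       P? []          unique = countSubsets-zero P?
countSubsets-unique (suc n) P? (true ∷ t)  unique = begin
  countSubsets (suc n) P?             ≡⟨ countSubsets-suc n P? ⟩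
  countSubsets n _ + countSubsets n _ ≡⟨ cong₂ _+_ (countSubsets-unique n _ t λ S p → ∷-injectiveʳ (unique _ p))
                                                   (countSubsets-none n _ λ S p → case unique _ p of λ ()) ⟩
  ⟦ does (P? (true ∷ t)) ⟧ + 0        ≡⟨ +-identityʳ _ ⟩
  ⟦ does (P? (true ∷ t)) ⟧            ∎
countSubsets-unique (suc n) P? (false ∷ t) unique = trans (countSubsets-suc n P?)
  (cong₂ _+_ (countSubsets-none n _ λ S p → case unique _ p of λ ())
             (countSubsets-unique n _ t λ S p → ∷-injectiveʳ (unique _ p)))

countSubsets-graph : ∀ n {m} {P : Subset (n + m) → Set} {Q : Subset n → Set}
                     (P? : Decidable P) (Q? : Decidable Q) (f : Subset n → Subset m) →
                     (∀ S T → P (S ++ T) → T ≡ f S) → (∀ S → P (S ++ f S) ⇔ Q S) →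
                     countSubsets (n + m) P? ≡ countSubsets n Q?
countSubsets-graph 0 {m} P? Q? f graph P⇔Q = begin
  countSubsets m P?        ≡⟨ countSubsets-unique m P? (f []) (graph []) ⟩
  ⟦ does (P? (f [])) ⟧     ≡⟨ cong ⟦_⟧ (does-⇔ (P⇔Q []) (P? _) (Q? _)) ⟩
  ⟦ does (Q? []) ⟧         ≡⟨ countSubsets-zero Q? ⟨
  countSubsets 0 Q?        ∎
countSubsets-graph (suc n) {m} P? Q? f graph P⇔Q = begin
  countSubsets (suc n + m) P?
    ≡⟨ countSubsets-suc (n + m) P? ⟩
  countSubsets (n + m) (P? ∘ (true ∷_)) + countSubsets (n + m) (P? ∘ (false ∷_))
    ≡⟨ cong₂ _+_ (half true) (half false) ⟩
  countSubsets n (Q? ∘ (true ∷_)) + countSubsets n (Q? ∘ (false ∷_))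
    ≡⟨ countSubsets-suc n Q? ⟨
  countSubsets (suc n) Q?
    ∎
  where
  half : ∀ b → countSubsets (n + m) (P? ∘ (b ∷_)) ≡ countSubsets n (Q? ∘ (b ∷_))
  half b = countSubsets-graph n _ _ (f ∘ (b ∷_)) (graph ∘ (b ∷_)) (P⇔Q ∘ (b ∷_))

degIn≡∑ : ∀ {n} (G : Graph n) (S : Subset n) v → degIn G S v ≡ ∑[ j < n ] ⟦ adj G v j ∧ j ∈ᵇ S ⟧
degIn≡∑ G S v = countᵇ-tabulate (λ j → adj G v j ∧ j ∈ᵇ S) id

deg≡degIn+degIn∁ : ∀ {n} (G : Graph n) (S : Subset n) v → deg G v ≡ degIn G S v + degIn G (∁ S) v
deg≡degIn+degIn∁ {n} G S v = begin
  deg G v                                    ≡⟨ countᵇ-tabulate (adj G v) id ⟩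
  ∑[ j < n ] ⟦ adj G v j ⟧                   ≡⟨ sum-cong-≗ split ⟩
  ∑[ j < n ] (inside j + outside j)          ≡⟨ ∑-distrib-+ inside outside ⟩
  ∑[ j < n ] inside j + ∑[ j < n ] outside j ≡⟨ cong₂ _+_ (degIn≡∑ G S v) (degIn≡∑ G (∁ S) v) ⟨
  degIn G S v + degIn G (∁ S) v              ∎
  where
  inside outside : Fin n → ℕ
  inside  j = ⟦ adj G v j ∧ j ∈ᵇ S ⟧
  outside j = ⟦ adj G v j ∧ j ∈ᵇ ∁ S ⟧
  split : ∀ j → ⟦ adj G v j ⟧ ≡ inside j + outside j
  split j rewrite lookup-map j not S = ⟦⟧-split (adj G v j) (j ∈ᵇ S)

degIn-++ : ∀ {n m} (H : Graph (n + m)) (S : Subset n) (T : Subset m) x →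
  degIn H (S ++ T) x ≡ ∑[ j < n ] ⟦ adj H x (j ↑ˡ m) ∧ j ∈ᵇ S ⟧ + ∑[ k < m ] ⟦ adj H x (n ↑ʳ k) ∧ k ∈ᵇ T ⟧
degIn-++ {n} {m} H S T x =
  trans (degIn≡∑ H (S ++ T) x)
  (trans (∑-↑ n _)
         (cong₂ _+_ (sum-cong-≗ λ j → cong (λ b → ⟦ adj H x (j ↑ˡ m) ∧ b ⟧) (lookup-++ˡ S T j))
                    (sum-cong-≗ λ k → cong (λ b → ⟦ adj H x (n ↑ʳ k) ∧ b ⟧) (lookup-++ʳ S T k))))

module OddExtension {n : ℕ} (G : Graph n) where

  m : ℕ
  m = numEven G

  Ḡ : Graph (n + m)
  Ḡ = oddExtension G

  adj-base-base : ∀ i j → adj Ḡ (i ↑ˡ m) (j ↑ˡ m) ≡ adj G i j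
  adj-base-base i j rewrite splitAt-↑ˡ n i m | splitAt-↑ˡ n j m = refl

  adj-base-pendant : ∀ i k → adj Ḡ (i ↑ˡ m) (n ↑ʳ k) ≡ does (owner G k ≟ i)
  adj-base-pendant i k rewrite splitAt-↑ˡ n i m | splitAt-↑ʳ n m k = refl

  adj-pendant-base : ∀ k j → adj Ḡ (n ↑ʳ k) (j ↑ˡ m) ≡ does (owner G k ≟ j)
  adj-pendant-base k j rewrite splitAt-↑ʳ n m k | splitAt-↑ˡ n j m = refl

  adj-pendant-pendant : ∀ k l → adj Ḡ (n ↑ʳ k) (n ↑ʳ l) ≡ false
  adj-pendant-pendant k l rewrite splitAt-↑ʳ n m k | splitAt-↑ʳ n m l = refl

  pendants-at : ∀ i → ∑[ k < m ] ⟦ does (owner G k ≟ i) ⟧ ≡ ⟦ does (isEven? (deg G i)) ⟧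
  pendants-at = occurrences-filter-allFin (λ v → isEven? (deg G v))

  closedNbhdMeet-pendant : ∀ S T k → closedNbhdMeet Ḡ (S ++ T) (n ↑ʳ k) ≡ ⟦ k ∈ᵇ T ⟧ + ⟦ owner G k ∈ᵇ S ⟧
  closedNbhdMeet-pendant S T k = cong₂ _+_ (cong ⟦_⟧ (lookup-++ʳ S T k)) (begin
    degIn Ḡ (S ++ T) (n ↑ʳ k)
      ≡⟨ degIn-++ Ḡ S T (n ↑ʳ k) ⟩
    ∑[ j < n ] ⟦ adj Ḡ (n ↑ʳ k) (j ↑ˡ m) ∧ j ∈ᵇ S ⟧ + ∑[ l < m ] ⟦ adj Ḡ (n ↑ʳ k) (n ↑ʳ l) ∧ l ∈ᵇ T ⟧
      ≡⟨ cong₂ _+_ (∑-single _ (owner G k) off-owner)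
                   (∑-zero _ λ l → cong (λ b → ⟦ b ∧ l ∈ᵇ T ⟧) (adj-pendant-pendant k l)) ⟩
    ⟦ adj Ḡ (n ↑ʳ k) (owner G k ↑ˡ m) ∧ owner G k ∈ᵇ S ⟧ + 0
      ≡⟨ +-identityʳ _ ⟩
    ⟦ adj Ḡ (n ↑ʳ k) (owner G k ↑ˡ m) ∧ owner G k ∈ᵇ S ⟧
      ≡⟨ cong (λ b → ⟦ b ∧ owner G k ∈ᵇ S ⟧) (trans (adj-pendant-base k _) (dec-true (owner G k ≟ owner G k) refl)) ⟩
    ⟦ owner G k ∈ᵇ S ⟧ ∎)
    where
    off-owner : ∀ j → j ≢ owner G k → ⟦ adj Ḡ (n ↑ʳ k) (j ↑ˡ m) ∧ j ∈ᵇ S ⟧ ≡ 0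
    off-owner j j≢owner rewrite adj-pendant-base k j | dec-false (owner G k ≟ j) (j≢owner ∘ ≡.sym) = refl

  closedNbhdMeet-base : ∀ S T i → closedNbhdMeet Ḡ (S ++ T) (i ↑ˡ m)
                                  ≡ closedNbhdMeet G S i + ∑[ k < m ] ⟦ does (owner G k ≟ i) ∧ k ∈ᵇ T ⟧
  closedNbhdMeet-base S T i = begin
    ⟦ (i ↑ˡ m) ∈ᵇ (S ++ T) ⟧ + degIn Ḡ (S ++ T) (i ↑ˡ m)
      ≡⟨ cong₂ _+_ (cong ⟦_⟧ (lookup-++ˡ S T i)) (degIn-++ Ḡ S T (i ↑ˡ m)) ⟩
    ⟦ i ∈ᵇ S ⟧ + (∑[ j < n ] ⟦ adj Ḡ (i ↑ˡ m) (j ↑ˡ m) ∧ j ∈ᵇ S ⟧ + ∑[ k < m ] ⟦ adj Ḡ (i ↑ˡ m) (n ↑ʳ k) ∧ k ∈ᵇ T ⟧)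
      ≡⟨ cong (⟦ i ∈ᵇ S ⟧ +_) (cong₂ _+_
           (trans (sum-cong-≗ λ j → cong (λ b → ⟦ b ∧ j ∈ᵇ S ⟧) (adj-base-base i j)) (≡.sym (degIn≡∑ G S i)))
           (sum-cong-≗ λ k → cong (λ b → ⟦ b ∧ k ∈ᵇ T ⟧) (adj-base-pendant i k))) ⟩
    ⟦ i ∈ᵇ S ⟧ + (degIn G S i + ∑[ k < m ] ⟦ does (owner G k ≟ i) ∧ k ∈ᵇ T ⟧)
      ≡⟨ +-assoc ⟦ i ∈ᵇ S ⟧ _ _ ⟨
    closedNbhdMeet G S i + ∑[ k < m ] ⟦ does (owner G k ≟ i) ∧ k ∈ᵇ T ⟧ ∎

  pendantsOutside : Subset n → Subset m
  pendantsOutside S = tabulate (λ k → not (owner G k ∈ᵇ S))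

  extend : Subset n → Subset (n + m)
  extend S = S ++ pendantsOutside S

  pendantsOutside-at : ∀ S i → ∑[ k < m ] ⟦ does (owner G k ≟ i) ∧ k ∈ᵇ pendantsOutside S ⟧
                               ≡ ⟦ not (i ∈ᵇ S) ∧ does (isEven? (deg G i)) ⟧
  pendantsOutside-at S i = trans (sum-cong-≗ at-owner) (scaled (not (i ∈ᵇ S)))
    where
    at-owner : ∀ k → ⟦ does (owner G k ≟ i) ∧ k ∈ᵇ pendantsOutside S ⟧ ≡ ⟦ does (owner G k ≟ i) ∧ not (i ∈ᵇ S) ⟧
    at-owner k rewrite lookup∘tabulate (λ k → not (owner G k ∈ᵇ S)) k with owner G k ≟ i
    ... | yes refl = refl
    ... | no  _    = refl
    scaled : ∀ c → ∑[ k < m ] ⟦ does (owner G k ≟ i) ∧ c ⟧ ≡ ⟦ c ∧ does (isEven? (deg G i)) ⟧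
    scaled true  = trans (sum-cong-≗ λ k → cong ⟦_⟧ (∧-identityʳ (does (owner G k ≟ i)))) (pendants-at i)
    scaled false = ∑-zero (λ k → ⟦ does (owner G k ≟ i) ∧ false ⟧) λ k → cong ⟦_⟧ (∧-zeroʳ _)

  closedNbhdMeet-extend : ∀ S i → closedNbhdMeet Ḡ (extend S) (i ↑ˡ m)
                                  ≡ closedNbhdMeet G S i + ⟦ not (i ∈ᵇ S) ∧ does (isEven? (deg G i)) ⟧
  closedNbhdMeet-extend S i =
    trans (closedNbhdMeet-base S (pendantsOutside S) i) (cong (closedNbhdMeet G S i +_) (pendantsOutside-at S i))

  base-odd⇔-∈ : ∀ S i → i ∈ᵇ S ≡ true → isOdd (closedNbhdMeet Ḡ (extend S) (i ↑ˡ m)) ⇔ isEven (degIn G S i)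
  base-odd⇔-∈ S i i∈S =
    subst (λ x → isOdd x ⇔ isEven (degIn G S i)) (≡.sym meet≡) (isOdd-suc⇔isEven (degIn G S i))
    where
    e : Bool
    e = does (isEven? (deg G i))
    meet≡ : closedNbhdMeet Ḡ (extend S) (i ↑ˡ m) ≡ suc (degIn G S i)
    meet≡ = begin
      closedNbhdMeet Ḡ (extend S) (i ↑ˡ m)             ≡⟨ closedNbhdMeet-extend S i ⟩
      ⟦ i ∈ᵇ S ⟧ + degIn G S i + ⟦ not (i ∈ᵇ S) ∧ e ⟧  ≡⟨ cong (λ b → ⟦ b ⟧ + degIn G S i + ⟦ not b ∧ e ⟧) i∈S ⟩
      suc (degIn G S i) + 0                            ≡⟨ +-identityʳ _ ⟩
      suc (degIn G S i)                                ∎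

  base-odd⇔-∉ : ∀ S i → i ∈ᵇ S ≡ false → isOdd (closedNbhdMeet Ḡ (extend S) (i ↑ˡ m)) ⇔ isEven (degIn G (∁ S) i)
  base-odd⇔-∉ S i i∉S =
    subst (λ x → isOdd x ⇔ isEven (degIn G (∁ S) i)) (≡.sym meet≡) (isOdd-+-⟦isEven?⟧ (degIn G S i) (degIn G (∁ S) i))
    where
    e : Bool
    e = does (isEven? (deg G i))
    meet≡ : closedNbhdMeet Ḡ (extend S) (i ↑ˡ m) ≡ degIn G S i + ⟦ does (isEven? (degIn G S i + degIn G (∁ S) i)) ⟧
    meet≡ = begin
      closedNbhdMeet Ḡ (extend S) (i ↑ˡ m)             ≡⟨ closedNbhdMeet-extend S i ⟩
      ⟦ i ∈ᵇ S ⟧ + degIn G S i + ⟦ not (i ∈ᵇ S) ∧ e ⟧  ≡⟨ cong (λ b → ⟦ b ⟧ + degIn G S i + ⟦ not b ∧ e ⟧) i∉S ⟩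
      degIn G S i + ⟦ e ⟧                              ≡⟨ cong (λ d → degIn G S i + ⟦ does (isEven? d) ⟧)
                                                               (deg≡degIn+degIn∁ G S i) ⟩
      degIn G S i + ⟦ does (isEven? (degIn G S i + degIn G (∁ S) i)) ⟧ ∎

  pendant-odd⇔ : ∀ S T k → isOdd (closedNbhdMeet Ḡ (S ++ T) (n ↑ʳ k)) ⇔ (k ∈ᵇ T ≡ not (owner G k ∈ᵇ S))
  pendant-odd⇔ S T k =
    subst (λ x → isOdd x ⇔ (k ∈ᵇ T ≡ not (owner G k ∈ᵇ S))) (≡.sym (closedNbhdMeet-pendant S T k))
          (isOdd-⟦⟧+⟦⟧ (k ∈ᵇ T) (owner G k ∈ᵇ S))

  cover⇒pendantsOutside : ∀ S T → OddParityCover Ḡ (S ++ T) → T ≡ pendantsOutside S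
  cover⇒pendantsOutside S T cover =
    trans (≡.sym (tabulate∘lookup T)) (tabulate-cong λ k → to (pendant-odd⇔ S T k) (cover (n ↑ʳ k)))

  cover⇔evenSplit : ∀ S → OddParityCover Ḡ (extend S) ⇔ EvenSplit G S
  cover⇔evenSplit S = mk⇔
    (λ cover → (λ i i∈S  → to (base-odd⇔-∈ S i i∈S) (cover (i ↑ˡ m)))
             , (λ i i∈∁S → to (base-odd⇔-∉ S i (∈∁⇒∉ i i∈∁S)) (cover (i ↑ˡ m))))
    (λ (even-S , even-∁S) → ↑-elim n (base even-S even-∁S) pendant)
    where
    ∈∁⇒∉ : ∀ i → i ∈ᵇ ∁ S ≡ true → i ∈ᵇ S ≡ false
    ∈∁⇒∉ i i∈∁S = not-injective (trans (≡.sym (lookup-map i not S)) i∈∁S)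
    ∉⇒∈∁ : ∀ i → i ∈ᵇ S ≡ false → i ∈ᵇ ∁ S ≡ true
    ∉⇒∈∁ i i∉S = trans (lookup-map i not S) (cong not i∉S)
    base : EvenInduced G S → EvenInduced G (∁ S) → ∀ i → isOdd (closedNbhdMeet Ḡ (extend S) (i ↑ˡ m))
    base even-S even-∁S i with i ∈ᵇ S in i∈ᵇS
    ... | true  = from (base-odd⇔-∈ S i i∈ᵇS) (even-S i i∈ᵇS)
    ... | false = from (base-odd⇔-∉ S i i∈ᵇS) (even-∁S i (∉⇒∈∁ i i∈ᵇS))
    pendant : ∀ k → isOdd (closedNbhdMeet Ḡ (extend S) (n ↑ʳ k))
    pendant k = from (pendant-odd⇔ S (pendantsOutside S) k) (lookup∘tabulate _ k)

proposition4p1 : ∀ {n : ℕ} (G : Graph n) → countSubsets n (EvenSplit? G) ≡ countSubsets (n + numEven G) (OddParityCover? (oddExtension G))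
proposition4p1 {n} G =
  ≡.sym (countSubsets-graph n (OddParityCover? Ḡ) (EvenSplit? G) pendantsOutside cover⇒pendantsOutside cover⇔evenSplit)
  where open OddExtension G
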